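{- Let $f(x)\in\mathbb{Q}[x]$ be monic, let $L/\mathbb{Q}$ be a finite Galois extension over which $f$ splits into linear factors, $\Gamma=\mathrm{Gal}(L/\mathbb{Q})$, let $\alpha_1,\ldots,\alpha_n$ be the roots of $f$ in $L$, and let $\Gamma_i=\mathrm{Gal}(L/\mathbb{Q}(\alpha_i))$. Define \[ S_2:=\bigcup_i\{\sigma\in\Gamma: C_\Gamma(\sigma)\subset\Gamma_i\}, \] where $C_\Gamma(\sigma)$ is the centralizer of $\sigma$ in $\Gamma$. Then for every $g\in A(L)$, \[ \{\sigma\in\Gamma: f(g(\sigma))=0\}\subseteq S_2, \] and there exists $g\in A(L)$ for which this containment is an equality.
   Context: $A(L)$ is the set of functions $g:\Gamma\to L$ satisfying $g(\sigma\tau\sigma^{ -1})=\sigma(g(\tau))$ for all $\sigma,\tau\in\Gamma$. -}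

module Defs where

open import Level using (Level; _⊔_) renaming (suc to lsuc)
open import Data.Nat using (ℕ; zero; suc)
open import Data.Fin using (Fin; zero; suc)
open import Data.List using (List; []; _∷_; _++_; map)
open import Data.List.Relation.Binary.Pointwise using (Pointwise)
open import Data.Product using (Σ; Σ-syntax; ∃; _×_; _,_)
open import Relation.Nullary using (¬_)
open import Relation.Binary.PropositionalEquality using (_≡_)
open import Algebra.Bundles using (CommutativeRing)
open import Algebra.Morphism.Structures using (IsRingHomomorphism)
open import Data.Rational as ℚ using (ℚ)
import Data.Rational.Base as ℚB

record Field (c ℓ : Level) : Set (lsuc (c ⊔ ℓ)) where
  field
    commutativeRing : CommutativeRing c ℓ
  open CommutativeRing commutativeRing public
  field
    1≉0     : ¬ (1# ≈ 0#)
    inverse : ∀ x → ¬ (x ≈ 0#) → Σ[ y ∈ Carrier ] (x * y ≈ 1#)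

-- A field L together with its structure of extension of ℚ, i.e. a ring
-- homomorphism ι : ℚ → L (necessarily injective).
record ExtOfℚ (c ℓ : Level) : Set (lsuc (c ⊔ ℓ)) where
  field
    field′ : Field c ℓ
  open Field field′ public
  field
    ι     : ℚ → Carrier
    ι-hom : IsRingHomomorphism ℚB.+-*-rawRing rawRing ι

module _ {c ℓ : Level} (L : ExtOfℚ c ℓ) where
  open ExtOfℚ L using (Carrier; _≈_; _+_; _*_; -_; 0#; 1#; ι; rawRing)

  sumL : (n : ℕ) → (Fin n → Carrier) → Carrier
  sumL zero    v = 0#
  sumL (suc n) v = v zero + sumL n (λ i → v (suc i))

  record Aut : Set (c ⊔ ℓ) where
    field
      σ       : Carrier → Carrier
      σ⁻¹     : Carrier → Carrier
      σ-hom   : IsRingHomomorphism rawRing rawRing σ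
      σ⁻¹-cong : ∀ {x y} → x ≈ y → σ⁻¹ x ≈ σ⁻¹ y
      invˡ    : ∀ x → σ⁻¹ (σ x) ≈ x
      invʳ    : ∀ x → σ (σ⁻¹ x) ≈ x
      fixesℚ  : ∀ q → σ (ι q) ≈ ι q

  open Aut public using () renaming (σ to ⟦_⟧ ; σ⁻¹ to ⟦_⟧⁻¹)

  _≈Γ_ : Aut → Aut → Set (c ⊔ ℓ)
  s ≈Γ t = ∀ x → ⟦ s ⟧ x ≈ ⟦ t ⟧ x

  -- L/ℚ is a finite Galois extension: L has a finite ℚ-basis of size n
  -- ([L:ℚ] = n) and Gal(L/ℚ) has exactly n elements.
  record IsFiniteGalois : Set (c ⊔ ℓ) where
    field
      degree  : ℕ
      basis   : Fin degree → Carrier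
      spans   : ∀ x → Σ[ a ∈ (Fin degree → ℚ) ] (x ≈ sumL degree (λ i → ι (a i) * basis i))
      indep   : ∀ (a : Fin degree → ℚ) → sumL degree (λ i → ι (a i) * basis i) ≈ 0# → ∀ i → a i ≡ ℚ.0ℚ
      enum    : Fin degree → Aut
      enum-surj : ∀ s → Σ[ i ∈ Fin degree ] (enum i ≈Γ s)
      enum-inj  : ∀ i j → enum i ≈Γ enum j → i ≡ j

  -- Polynomials over ℚ: coefficient lists, constant term first.
  Polyℚ : Set
  Polyℚ = List ℚ

  Monic : Polyℚ → Set
  Monic f = Σ[ cs ∈ List ℚ ] (f ≡ cs ++ (ℚ.1ℚ ∷ []))

  eval : Polyℚ → Carrier → Carrier
  eval []       x = 0#
  eval (a ∷ as) x = ι a + x * eval as x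

  -- polynomials over L, and multiplication by a linear factor (x - a):
  -- (x - a)(p₀ + x Q) = -a p₀ + x (p₀ + (x - a) Q)
  addHead : Carrier → List Carrier → List Carrier
  addHead b []       = b ∷ []
  addHead b (q ∷ qs) = (b + q) ∷ qs

  mulLin : Carrier → List Carrier → List Carrier
  mulLin a []       = []
  mulLin a (p ∷ ps) = (- (a * p)) ∷ addHead p (mulLin a ps)

  prodLin : (m : ℕ) → (Fin m → Carrier) → List Carrier
  prodLin zero    α = 1# ∷ []
  prodLin (suc m) α = mulLin (α zero) (prodLin m (λ i → α (suc i)))

  SplitsAs : Polyℚ → (m : ℕ) → (Fin m → Carrier) → Set (c ⊔ ℓ)
  SplitsAs f m α = Pointwise _≈_ (map ι f) (prodLin m α)

  -- The subfield ℚ(a) generated by a: quotients p(a)/q(a) with q(a) ≠ 0.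
  InQAdj : Carrier → Carrier → Set ℓ
  InQAdj a x = Σ[ p ∈ Polyℚ ] Σ[ q ∈ Polyℚ ] (¬ (eval q a ≈ 0#) × (x * eval q a ≈ eval p a))

  InGalOver : Carrier → Aut → Set (c ⊔ ℓ)
  InGalOver a t = ∀ x → InQAdj a x → ⟦ t ⟧ x ≈ x

  InCentraliser : Aut → Aut → Set (c ⊔ ℓ)
  InCentraliser s t = ∀ x → ⟦ t ⟧ (⟦ s ⟧ x) ≈ ⟦ s ⟧ (⟦ t ⟧ x)

  InS₂ : (m : ℕ) → (Fin m → Carrier) → Aut → Set (c ⊔ ℓ)
  InS₂ m α s = Σ[ i ∈ Fin m ] (∀ t → InCentraliser s t → InGalOver (α i) t)

  -- A(L): functions g : Γ → L (well defined on Γ) with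
  -- g(σ τ σ⁻¹) = σ(g τ); "ρ = σ τ σ⁻¹" is written pointwise.
  InA : (Aut → Carrier) → Set (c ⊔ ℓ)
  InA g = (∀ s t → s ≈Γ t → g s ≈ g t)
        × (∀ s t r → (∀ x → ⟦ r ⟧ x ≈ ⟦ s ⟧ (⟦ t ⟧ (⟦ s ⟧⁻¹ x))) → g r ≈ ⟦ s ⟧ (g t))

  IsRootOf : Polyℚ → Carrier → Set ℓ
  IsRootOf f x = eval f x ≈ 0#

module Submission where

-- If f(g σ) = 0 then g σ = αᵢ for some i.  Every τ in the
-- centraliser C(σ) satisfies τ σ τ⁻¹ = σ, so equivariance of g gives
-- τ(αᵢ) = τ(g σ) = g σ = αᵢ; hence C(σ) ⊆ Gal(L/ℚ(αᵢ)), i.e. σ ∈ S₂.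
--
-- Choose in every conjugacy class a canonical representative
-- ρ (the least index in the enumeration of Γ).  If some αᵢ is fixed by all
-- of C(ρ), put g(τ ρ τ⁻¹) = τ(αᵢ), and g = 0 on the class otherwise.  Two
-- conjugators of ρ differ by an element of C(ρ), so g is well defined and
-- equivariant; S₂ is a union of conjugacy classes, so g σ is a root exactly
-- on S₂.  Since L is finite-dimensional over ℚ, equality in L and in Γ is
-- decidable, which makes all of these choices computable.

open import Defs hiding (_≈Γ_)
open import Level using (Level; _⊔_)
open import Data.Nat using (ℕ; zero; suc)
open import Data.Fin using (Fin; zero; suc)
import Data.Fin.Properties as Finₚ
open import Data.List using (List; []; _∷_; map)
open import Data.List.Relation.Binary.Pointwise using (Pointwise; []; _∷_)
open import Data.Product using (Σ-syntax; ∃; _×_; _,_; proj₁; proj₂)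
open import Data.Empty using (⊥-elim)
open import Relation.Nullary using (¬_; Dec; yes; no; _→-dec_)
open import Relation.Nullary.Decidable using (map′)
open import Relation.Binary.PropositionalEquality as ≡ using (_≡_)
open import Function.Bundles using (_⇔_; mk⇔; Equivalence)
open import Algebra.Bundles using (Ring)
open import Algebra.Morphism.Structures using (IsRingHomomorphism)
import Algebra.Morphism.Construct.Identity as IdentityHom
import Algebra.Morphism.Construct.Composition as CompositionHom
import Algebra.Morphism.Consequences as HomConsequences
open import Function.Definitions using (Inverseᵇ)
import Algebra.Properties.Ring as RingProperties
import Relation.Binary.Reasoning.Setoid as SetoidReasoning
open import Data.Rational as ℚ using (ℚ)

module FieldFacts {c ℓ : Level} (F : Field c ℓ) where
  open Field F
  open SetoidReasoning setoid

  *-cancelʳ-nonzero : ∀ {w y z} → ¬ (w ≈ 0#) → y * w ≈ z * w → y ≈ z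
  *-cancelʳ-nonzero {w} {y} {z} w≉0 yw≈zw = begin
    y              ≈⟨ *-identityʳ y ⟨
    y * 1#         ≈⟨ *-congˡ ww⁻¹≈1 ⟨
    y * (w * w⁻¹)  ≈⟨ *-assoc y w w⁻¹ ⟨
    (y * w) * w⁻¹  ≈⟨ *-congʳ yw≈zw ⟩
    (z * w) * w⁻¹  ≈⟨ *-assoc z w w⁻¹ ⟩
    z * (w * w⁻¹)  ≈⟨ *-congˡ ww⁻¹≈1 ⟩
    z * 1#         ≈⟨ *-identityʳ z ⟩
    z              ∎
    where
    w⁻¹ = proj₁ (inverse w w≉0)
    ww⁻¹≈1 = proj₂ (inverse w w≉0)

  nonzero-*-zero : ∀ {w y} → ¬ (w ≈ 0#) → w * y ≈ 0# → y ≈ 0#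
  nonzero-*-zero {w} {y} w≉0 wy≈0 = *-cancelʳ-nonzero w≉0 (begin
    y * w   ≈⟨ *-comm y w ⟩
    w * y   ≈⟨ wy≈0 ⟩
    0#      ≈⟨ zeroˡ w ⟨
    0# * w  ∎)

module InverseHomomorphism {c ℓ : Level} (R : Ring c ℓ) where
  open Ring R
  open SetoidReasoning setoid

  module _ {f g : Carrier → Carrier} (f-hom : IsRingHomomorphism rawRing rawRing f)
           (g-cong : ∀ {x y} → x ≈ y → g x ≈ g y)
           (f∘g : ∀ x → f (g x) ≈ x) (g∘f : ∀ x → g (f x) ≈ x) where
    private module F = IsRingHomomorphism f-hom

    inverse-fixes : ∀ {a} → f a ≈ a → g a ≈ a
    inverse-fixes {a} fa≈a = trans (g-cong (sym fa≈a)) (g∘f a)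

    private
      bijection : Inverseᵇ _≈_ _≈_ f g
      bijection = (λ {x} y≈gx → trans (F.⟦⟧-cong y≈gx) (f∘g x))
                , (λ {x} y≈fx → trans (g-cong y≈fx) (g∘f x))

      -‿homo : ∀ x → g (- x) ≈ - g x
      -‿homo x = begin
        g (- x)          ≈⟨ g-cong (-‿cong (f∘g x)) ⟨
        g (- f (g x))    ≈⟨ g-cong (F.-‿homo (g x)) ⟨
        g (f (- g x))    ≈⟨ g∘f (- g x) ⟩
        - g x            ∎

    inverse-isRingHomomorphism : IsRingHomomorphism rawRing rawRing g
    inverse-isRingHomomorphism = record
      { isSemiringHomomorphism = record
        { isNearSemiringHomomorphism = record
          { +-isMonoidHomomorphism = record
            { isMagmaHomomorphism = record
              { isRelHomomorphism = record { cong = g-cong }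
              ; homo = HomConsequences.homomorphic₂-inv +-magma +-magma g-cong bijection F.+-homo }
            ; ε-homo = inverse-fixes F.0#-homo }
          ; *-homo = HomConsequences.homomorphic₂-inv *-magma *-magma g-cong bijection F.*-homo }
        ; 1#-homo = inverse-fixes F.1#-homo }
      ; -‿homo = -‿homo }

module Automorphisms {c ℓ : Level} (L : ExtOfℚ c ℓ) where
  open ExtOfℚ L hiding (zero)
  open SetoidReasoning setoid
  open FieldFacts field′

  Γ : Set (c ⊔ ℓ)
  Γ = Aut L

  _≈Γ_ : Γ → Γ → Set (c ⊔ ℓ)
  _≈Γ_ = Defs._≈Γ_ L

  module Homo (s : Γ) = IsRingHomomorphism (Aut.σ-hom s)

  idΓ : Γ
  idΓ = record
    { σ = λ x → x ; σ⁻¹ = λ x → x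
    ; σ-hom = IdentityHom.isRingHomomorphism rawRing refl
    ; σ⁻¹-cong = λ x≈y → x≈y
    ; invˡ = λ _ → refl ; invʳ = λ _ → refl ; fixesℚ = λ _ → refl }

  infixr 9 _∘Γ_
  _∘Γ_ : Γ → Γ → Γ
  s ∘Γ t = record
    { σ = λ x → ⟦ s ⟧ (⟦ t ⟧ x) ; σ⁻¹ = λ x → ⟦ t ⟧⁻¹ (⟦ s ⟧⁻¹ x)
    ; σ-hom = CompositionHom.isRingHomomorphism trans (Aut.σ-hom t) (Aut.σ-hom s)
    ; σ⁻¹-cong = λ x≈y → Aut.σ⁻¹-cong t (Aut.σ⁻¹-cong s x≈y)
    ; invˡ = λ x → trans (Aut.σ⁻¹-cong t (Aut.invˡ s (⟦ t ⟧ x))) (Aut.invˡ t x)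
    ; invʳ = λ x → trans (Homo.⟦⟧-cong s (Aut.invʳ t (⟦ s ⟧⁻¹ x))) (Aut.invʳ s x)
    ; fixesℚ = λ q → trans (Homo.⟦⟧-cong s (Aut.fixesℚ t q)) (Aut.fixesℚ s q) }

  infix 10 _⁻¹Γ
  _⁻¹Γ : Γ → Γ
  s ⁻¹Γ = record
    { σ = ⟦ s ⟧⁻¹ ; σ⁻¹ = ⟦ s ⟧
    ; σ-hom = inverse-isRingHomomorphism (Aut.σ-hom s) (Aut.σ⁻¹-cong s) (Aut.invʳ s) (Aut.invˡ s)
    ; σ⁻¹-cong = Homo.⟦⟧-cong s
    ; invˡ = Aut.invʳ s ; invʳ = Aut.invˡ s
    ; fixesℚ = λ q → inverse-fixes (Aut.σ-hom s) (Aut.σ⁻¹-cong s) (Aut.invʳ s) (Aut.invˡ s)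
                                    (Aut.fixesℚ s q) }
    where open InverseHomomorphism ring

  ⁻¹-resp : ∀ {s t} → s ≈Γ t → ∀ x → ⟦ s ⟧⁻¹ x ≈ ⟦ t ⟧⁻¹ x
  ⁻¹-resp {s} {t} s≈t x = begin
    ⟦ s ⟧⁻¹ x                    ≈⟨ Aut.σ⁻¹-cong s (Aut.invʳ t x) ⟨
    ⟦ s ⟧⁻¹ (⟦ t ⟧ (⟦ t ⟧⁻¹ x))  ≈⟨ Aut.σ⁻¹-cong s (s≈t _) ⟨
    ⟦ s ⟧⁻¹ (⟦ s ⟧ (⟦ t ⟧⁻¹ x))  ≈⟨ Aut.invˡ s _ ⟩
    ⟦ t ⟧⁻¹ x                    ∎

  Conj : Γ → Γ → Γ → Set (c ⊔ ℓ)
  Conj τ ρ σ = ∀ x → ⟦ σ ⟧ x ≈ ⟦ τ ⟧ (⟦ ρ ⟧ (⟦ τ ⟧⁻¹ x))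

  conj-intertwines : ∀ {τ ρ σ} → Conj τ ρ σ → ∀ x → ⟦ σ ⟧ (⟦ τ ⟧ x) ≈ ⟦ τ ⟧ (⟦ ρ ⟧ x)
  conj-intertwines {τ} {ρ} σ=τρτ⁻¹ x =
    trans (σ=τρτ⁻¹ (⟦ τ ⟧ x)) (Homo.⟦⟧-cong τ (Homo.⟦⟧-cong ρ (Aut.invˡ τ x)))

  conj-resp : ∀ {τ τ′ ρ σ} → τ ≈Γ τ′ → Conj τ ρ σ → Conj τ′ ρ σ
  conj-resp {τ} {τ′} {ρ} τ≈τ′ σ=τρτ⁻¹ x = trans (σ=τρτ⁻¹ x)
    (trans (Homo.⟦⟧-cong τ (Homo.⟦⟧-cong ρ (⁻¹-resp {τ} {τ′} τ≈τ′ x))) (τ≈τ′ _))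

  conj-compose : ∀ {τ ρ s t r} → Conj τ ρ t → Conj s t r → Conj (s ∘Γ τ) ρ r
  conj-compose {s = s} t=τρτ⁻¹ r=sts⁻¹ x =
    trans (r=sts⁻¹ x) (Homo.⟦⟧-cong s (t=τρτ⁻¹ _))

  conj-inverse : ∀ {s t r} → Conj s t r → Conj (s ⁻¹Γ) r t
  conj-inverse {s} {t} {r} r=sts⁻¹ x = begin
    ⟦ t ⟧ x                      ≈⟨ Aut.invˡ s _ ⟨
    ⟦ s ⟧⁻¹ (⟦ s ⟧ (⟦ t ⟧ x))    ≈⟨ Aut.σ⁻¹-cong s (conj-intertwines {s} {t} {r} r=sts⁻¹ x)
                                  ⟨
    ⟦ s ⟧⁻¹ (⟦ r ⟧ (⟦ s ⟧ x))    ∎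

  centralises-resp : ∀ {s t t′} → t ≈Γ t′ → InCentraliser L s t → InCentraliser L s t′
  centralises-resp {s} t≈t′ ts=st x =
    trans (sym (t≈t′ _)) (trans (ts=st x) (Homo.⟦⟧-cong s (t≈t′ x)))

  centraliser-conj-self : ∀ {s t} → InCentraliser L s t → Conj t s s
  centraliser-conj-self {s} {t} ts=st x =
    sym (trans (ts=st (⟦ t ⟧⁻¹ x)) (Homo.⟦⟧-cong s (Aut.invʳ t x)))

  centraliser-conj : ∀ {τ ρ σ t} → Conj τ ρ σ → InCentraliser L ρ t →
                     InCentraliser L σ (τ ∘Γ t ∘Γ τ ⁻¹Γ)
  centraliser-conj {τ} {ρ} {σ} {t} σ=τρτ⁻¹ tρ=ρt x = begin
    ⟦ τ ⟧ (⟦ t ⟧ (⟦ τ ⟧⁻¹ (⟦ σ ⟧ x)))   ≈⟨ Homo.⟦⟧-cong τ (Homo.⟦⟧-cong t τ⁻¹σ=ρτ⁻¹) ⟩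
    ⟦ τ ⟧ (⟦ t ⟧ (⟦ ρ ⟧ (⟦ τ ⟧⁻¹ x)))   ≈⟨ Homo.⟦⟧-cong τ (tρ=ρt _) ⟩
    ⟦ τ ⟧ (⟦ ρ ⟧ (⟦ t ⟧ (⟦ τ ⟧⁻¹ x)))   ≈⟨ conj-intertwines {τ} {ρ} {σ} σ=τρτ⁻¹ _ ⟨
    ⟦ σ ⟧ (⟦ τ ⟧ (⟦ t ⟧ (⟦ τ ⟧⁻¹ x)))   ∎
    where
    τ⁻¹σ=ρτ⁻¹ : ⟦ τ ⟧⁻¹ (⟦ σ ⟧ x) ≈ ⟦ ρ ⟧ (⟦ τ ⟧⁻¹ x)
    τ⁻¹σ=ρτ⁻¹ = trans (Aut.σ⁻¹-cong τ (σ=τρτ⁻¹ x)) (Aut.invˡ τ _)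

  CentFixes : Γ → Carrier → Set (c ⊔ ℓ)
  CentFixes ρ a = ∀ t → InCentraliser L ρ t → ⟦ t ⟧ a ≈ a

  centFixes-resp : ∀ {ρ a b} → a ≈ b → CentFixes ρ a → CentFixes ρ b
  centFixes-resp a≈b fixes t t∈C =
    trans (Homo.⟦⟧-cong t (sym a≈b)) (trans (fixes t t∈C) a≈b)

  centFixes-conj : ∀ {τ ρ σ a} → Conj τ ρ σ → CentFixes σ a → CentFixes ρ (⟦ τ ⟧⁻¹ a)
  centFixes-conj {τ} {ρ} {σ} {a} σ=τρτ⁻¹ fixes t t∈C =
    trans (sym (Aut.invˡ τ (⟦ t ⟧ (⟦ τ ⟧⁻¹ a)))) (Aut.σ⁻¹-cong τ (fixes (τ ∘Γ t ∘Γ τ ⁻¹Γ) τtτ⁻¹∈C))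
    where
    τtτ⁻¹∈C = centraliser-conj {τ} {ρ} {σ} {t} σ=τρτ⁻¹ t∈C

  -- Two conjugators of ρ onto the same σ differ by an element of C(ρ), so
  -- they agree on every point fixed by C(ρ).
  conjugators-agree : ∀ {ρ σ τ₁ τ₂ a} → CentFixes ρ a → Conj τ₁ ρ σ → Conj τ₂ ρ σ →
                      ⟦ τ₁ ⟧ a ≈ ⟦ τ₂ ⟧ a
  conjugators-agree {ρ} {σ} {τ₁} {τ₂} {a} fixes σ=τ₁ρτ₁⁻¹ σ=τ₂ρτ₂⁻¹ = begin
    ⟦ τ₁ ⟧ a                      ≈⟨ Homo.⟦⟧-cong τ₁ (fixes u u∈C) ⟨
    ⟦ τ₁ ⟧ (⟦ τ₁ ⟧⁻¹ (⟦ τ₂ ⟧ a))  ≈⟨ Aut.invʳ τ₁ _ ⟩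
    ⟦ τ₂ ⟧ a                      ∎
    where
    u = τ₁ ⁻¹Γ ∘Γ τ₂
    u∈C : InCentraliser L ρ u
    u∈C x = begin
      ⟦ τ₁ ⟧⁻¹ (⟦ τ₂ ⟧ (⟦ ρ ⟧ x))          ≈⟨ Aut.σ⁻¹-cong τ₁ τ₂ρ=στ₂ ⟨
      ⟦ τ₁ ⟧⁻¹ (⟦ σ ⟧ (⟦ τ₂ ⟧ x))          ≈⟨ Aut.σ⁻¹-cong τ₁ (σ=τ₁ρτ₁⁻¹ _) ⟩
      ⟦ τ₁ ⟧⁻¹ (⟦ τ₁ ⟧ (⟦ ρ ⟧ (⟦ u ⟧ x)))  ≈⟨ Aut.invˡ τ₁ _ ⟩
      ⟦ ρ ⟧ (⟦ u ⟧ x)                      ∎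
      where τ₂ρ=στ₂ = conj-intertwines {τ₂} {ρ} {σ} σ=τ₂ρτ₂⁻¹ x

  -- Automorphisms fix ℚ, hence commute with evaluation of rational
  -- polynomials and permute their roots.
  eval-cong : ∀ f {x y} → x ≈ y → eval L f x ≈ eval L f y
  eval-cong []      x≈y = refl
  eval-cong (a ∷ f) x≈y = +-congˡ (*-cong x≈y (eval-cong f x≈y))

  eval-commutes : ∀ (s : Γ) f x → ⟦ s ⟧ (eval L f x) ≈ eval L f (⟦ s ⟧ x)
  eval-commutes s []      x = Homo.0#-homo s
  eval-commutes s (a ∷ f) x = begin
    ⟦ s ⟧ (ι a + x * eval L f x)               ≈⟨ Homo.+-homo s _ _ ⟩
    ⟦ s ⟧ (ι a) + ⟦ s ⟧ (x * eval L f x)       ≈⟨ +-cong (Aut.fixesℚ s a) (Homo.*-homo s x _) ⟩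
    ι a + ⟦ s ⟧ x * ⟦ s ⟧ (eval L f x)         ≈⟨ +-congˡ (*-congˡ (eval-commutes s f x)) ⟩
    ι a + ⟦ s ⟧ x * eval L f (⟦ s ⟧ x)         ∎

  root-preserved : ∀ (s : Γ) f {x} → IsRootOf L f x → IsRootOf L f (⟦ s ⟧ x)
  root-preserved s f {x} root =
    trans (sym (eval-commutes s f x)) (trans (Homo.⟦⟧-cong s root) (Homo.0#-homo s))

  -- t ∈ Gal(L/ℚ(a)) iff t fixes a: ℚ(a) consists of quotients p(a)/q(a).
  galOver⇔fixes : ∀ {a} (t : Γ) → InGalOver L a t ⇔ (⟦ t ⟧ a ≈ a)
  galOver⇔fixes {a} t = mk⇔ fixes-a fixes-ℚ⟨a⟩
    where
    module ιHom = IsRingHomomorphism ι-hom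
    eval-1 : eval L (ℚ.1ℚ ∷ []) a ≈ 1#
    eval-1 = trans (+-cong ιHom.1#-homo (zeroʳ a)) (+-identityʳ 1#)
    eval-x : eval L (ℚ.0ℚ ∷ ℚ.1ℚ ∷ []) a ≈ a
    eval-x = trans (+-cong ιHom.0#-homo (trans (*-congˡ eval-1) (*-identityʳ a))) (+-identityˡ a)
    a∈ℚ⟨a⟩ : InQAdj L a a
    a∈ℚ⟨a⟩ = ℚ.0ℚ ∷ ℚ.1ℚ ∷ [] , ℚ.1ℚ ∷ [] , (λ 1≈0 → 1≉0 (trans (sym eval-1) 1≈0))
           , trans (*-congˡ eval-1) (trans (*-identityʳ a) (sym eval-x))
    fixes-a : InGalOver L a t → ⟦ t ⟧ a ≈ a
    fixes-a t∈Gal = t∈Gal a a∈ℚ⟨a⟩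
    fixes-ℚ⟨a⟩ : ⟦ t ⟧ a ≈ a → InGalOver L a t
    fixes-ℚ⟨a⟩ ta≈a x (p , q , q≉0 , xq≈p) = *-cancelʳ-nonzero q≉0 (begin
      ⟦ t ⟧ x * eval L q a             ≈⟨ *-congˡ (eval-cong q ta≈a) ⟨
      ⟦ t ⟧ x * eval L q (⟦ t ⟧ a)     ≈⟨ *-congˡ (eval-commutes t q a) ⟨
      ⟦ t ⟧ x * ⟦ t ⟧ (eval L q a)     ≈⟨ Homo.*-homo t x _ ⟨
      ⟦ t ⟧ (x * eval L q a)           ≈⟨ Homo.⟦⟧-cong t xq≈p ⟩
      ⟦ t ⟧ (eval L p a)               ≈⟨ eval-commutes t p a ⟩
      eval L p (⟦ t ⟧ a)               ≈⟨ eval-cong p ta≈a ⟩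
      eval L p a                       ≈⟨ xq≈p ⟨
      x * eval L q a                   ∎)

module SplitPolynomials {c ℓ : Level} (L : ExtOfℚ c ℓ) where
  open ExtOfℚ L hiding (zero)
  open SetoidReasoning setoid
  open FieldFacts field′
  open RingProperties ring using (-‿distribˡ-*; x∙y⁻¹≈ε⇒x≈y)

  evalL : List Carrier → Carrier → Carrier
  evalL []       x = 0#
  evalL (a ∷ as) x = a + x * evalL as x

  eval-via-ι : ∀ f x → eval L f x ≈ evalL (map ι f) x
  eval-via-ι []      x = refl
  eval-via-ι (a ∷ f) x = +-congˡ (*-congˡ (eval-via-ι f x))

  evalL-pointwise : ∀ {p q} → Pointwise _≈_ p q → ∀ x → evalL p x ≈ evalL q x
  evalL-pointwise []           x = refl
  evalL-pointwise (a≈b ∷ p≈q) x = +-cong a≈b (*-congˡ (evalL-pointwise p≈q x))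

  evalL-addHead : ∀ b q x → evalL (addHead L b q) x ≈ b + evalL q x
  evalL-addHead b []       x = +-congˡ (zeroʳ x)
  evalL-addHead b (q ∷ qs) x = +-assoc b q _

  linear-factor-step : ∀ x a p E → - (a * p) + x * (p + (x - a) * E) ≈ (x - a) * (p + x * E)
  linear-factor-step x a p E = begin
    - (a * p) + x * (p + y * E)          ≈⟨ +-congˡ (distribˡ x p (y * E)) ⟩
    - (a * p) + (x * p + x * (y * E))    ≈⟨ +-assoc _ _ _ ⟨
    (- (a * p) + x * p) + x * (y * E)    ≈⟨ +-cong (+-comm _ _) xyE=yxE ⟩
    (x * p + - (a * p)) + y * (x * E)    ≈⟨ +-congʳ yp=xp-ap ⟨
    y * p + y * (x * E)                  ≈⟨ distribˡ y p (x * E) ⟨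
    y * (p + x * E)                      ∎
    where
    y = x - a
    xyE=yxE : x * (y * E) ≈ y * (x * E)
    xyE=yxE = trans (sym (*-assoc x y E)) (trans (*-congʳ (*-comm x y)) (*-assoc y x E))
    yp=xp-ap : y * p ≈ x * p + - (a * p)
    yp=xp-ap = trans (distribʳ p x (- a)) (+-congˡ (sym (-‿distribˡ-* a p)))

  evalL-mulLin : ∀ a p x → evalL (mulLin L a p) x ≈ (x - a) * evalL p x
  evalL-mulLin a []       x = sym (zeroʳ _)
  evalL-mulLin a (p ∷ ps) x = begin
    - (a * p) + x * evalL (addHead L p (mulLin L a ps)) x
      ≈⟨ +-congˡ (*-congˡ (evalL-addHead p (mulLin L a ps) x)) ⟩
    - (a * p) + x * (p + evalL (mulLin L a ps) x)
      ≈⟨ +-congˡ (*-congˡ (+-congˡ (evalL-mulLin a ps x))) ⟩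
    - (a * p) + x * (p + (x - a) * evalL ps x)
      ≈⟨ linear-factor-step x a p (evalL ps x) ⟩
    (x - a) * (p + x * evalL ps x)
      ∎

  prodLin-vanishes : ∀ n (α : Fin n → Carrier) i → evalL (prodLin L n α) (α i) ≈ 0#
  prodLin-vanishes (suc n) α i = trans (evalL-mulLin (α zero) rest (α i)) (vanish i)
    where
    rest = prodLin L n (λ j → α (suc j))
    vanish : ∀ i → (α i - α zero) * evalL rest (α i) ≈ 0#
    vanish zero    = trans (*-congʳ (-‿inverseʳ (α zero))) (zeroˡ _)
    vanish (suc i) = trans (*-congˡ (prodLin-vanishes n _ i)) (zeroʳ _)

  prodLin-roots : (∀ x y → Dec (x ≈ y)) → ∀ n (α : Fin n → Carrier) x →
                  evalL (prodLin L n α) x ≈ 0# → ∃ λ i → x ≈ α i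
  prodLin-roots _≟_ zero α x 1+x0≈0 =
    ⊥-elim (1≉0 (trans (sym (trans (+-congˡ (zeroʳ x)) (+-identityʳ 1#))) 1+x0≈0))
  prodLin-roots _≟_ (suc n) α x root with x ≟ α zero
  ... | yes x≈α₀ = zero , x≈α₀
  ... | no  x≉α₀ =
    let i , x≈αᵢ = prodLin-roots _≟_ n (λ j → α (suc j)) x
                     (nonzero-*-zero (λ x-α₀≈0 → x≉α₀ (x∙y⁻¹≈ε⇒x≈y x (α zero) x-α₀≈0))
                                     (trans (sym (evalL-mulLin (α zero) rest x)) root))
    in suc i , x≈αᵢ
    where rest = prodLin L n (λ j → α (suc j))

  module _ {f : Polyℚ L} {n : ℕ} {α : Fin n → Carrier} (splits : SplitsAs L f n α) where
    eval-split : ∀ x → eval L f x ≈ evalL (prodLin L n α) x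
    eval-split x = trans (eval-via-ι f x) (evalL-pointwise splits x)

    α-is-root : ∀ i → IsRootOf L f (α i)
    α-is-root i = trans (eval-split (α i)) (prodLin-vanishes n α i)

    root-is-some-α : (∀ x y → Dec (x ≈ y)) → ∀ {x} → IsRootOf L f x → ∃ λ i → x ≈ α i
    root-is-some-α _≟_ {x} root = prodLin-roots _≟_ n α x (trans (sym (eval-split x)) root)

-- Finiteness: L has a finite ℚ-basis and Γ is enumerated, so equality in L
-- and in Γ, and quantification over Γ, are decidable.
module FiniteGalois {c ℓ : Level} (L : ExtOfℚ c ℓ) (G : IsFiniteGalois L) where
  open ExtOfℚ L hiding (zero)
  open IsFiniteGalois G
  open Automorphisms L
  open SetoidReasoning setoid
  open RingProperties ring using (x∙y⁻¹≈ε⇒x≈y; x≈y⇒x∙y⁻¹≈ε)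
  private module ιHom = IsRingHomomorphism ι-hom

  coords : Carrier → Fin degree → ℚ
  coords x = proj₁ (spans x)

  sumL-cong : ∀ n {u v : Fin n → Carrier} → (∀ i → u i ≈ v i) → sumL L n u ≈ sumL L n v
  sumL-cong zero    u≈v = refl
  sumL-cong (suc n) u≈v = +-cong (u≈v zero) (sumL-cong n (λ i → u≈v (suc i)))

  sumL-zero : ∀ n (u : Fin n → Carrier) → (∀ i → u i ≈ 0#) → sumL L n u ≈ 0#
  sumL-zero zero    u u≈0 = refl
  sumL-zero (suc n) u u≈0 =
    trans (+-cong (u≈0 zero) (sumL-zero n _ (λ i → u≈0 (suc i)))) (+-identityˡ 0#)

  sumL-commutes : ∀ (s : Γ) n (u : Fin n → Carrier) →
                  ⟦ s ⟧ (sumL L n u) ≈ sumL L n (λ i → ⟦ s ⟧ (u i))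
  sumL-commutes s zero    u = Homo.0#-homo s
  sumL-commutes s (suc n) u = trans (Homo.+-homo s _ _) (+-congˡ (sumL-commutes s n _))

  ≈0? : ∀ x → Dec (x ≈ 0#)
  ≈0? x = map′ coords-zero (λ x≈0 → indep (coords x) (trans (sym (proj₂ (spans x))) x≈0))
               (Finₚ.all? (λ i → coords x i ℚ.≟ ℚ.0ℚ))
    where
    coords-zero : (∀ i → coords x i ≡ ℚ.0ℚ) → x ≈ 0#
    coords-zero all0 = trans (proj₂ (spans x)) (sumL-zero degree _ λ i → begin
      ι (coords x i) * basis i  ≈⟨ *-congʳ (reflexive (≡.cong ι (all0 i))) ⟩
      ι ℚ.0ℚ * basis i          ≈⟨ *-congʳ ιHom.0#-homo ⟩
      0# * basis i              ≈⟨ zeroˡ _ ⟩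
      0#                        ∎)

  _≟_ : ∀ x y → Dec (x ≈ y)
  x ≟ y = map′ (x∙y⁻¹≈ε⇒x≈y x y) x≈y⇒x∙y⁻¹≈ε (≈0? (x - y))

  -- Automorphisms are ℚ-linear, so they are determined by the basis images.
  basis-expansion : ∀ (s : Γ) x → ⟦ s ⟧ x ≈ sumL L degree (λ i → ι (coords x i) * ⟦ s ⟧ (basis i))
  basis-expansion s x = begin
    ⟦ s ⟧ x                                               ≈⟨ Homo.⟦⟧-cong s (proj₂ (spans x)) ⟩
    ⟦ s ⟧ (sumL L degree (λ i → ι (coords x i) * basis i)) ≈⟨ sumL-commutes s degree _ ⟩
    sumL L degree (λ i → ⟦ s ⟧ (ι (coords x i) * basis i)) ≈⟨ sumL-cong degree linear ⟩
    sumL L degree (λ i → ι (coords x i) * ⟦ s ⟧ (basis i)) ∎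
    where
    linear : ∀ i → ⟦ s ⟧ (ι (coords x i) * basis i) ≈ ι (coords x i) * ⟦ s ⟧ (basis i)
    linear i = trans (Homo.*-homo s _ _) (*-congʳ (Aut.fixesℚ s _))

  _≟Γ_ : ∀ s t → Dec (s ≈Γ t)
  s ≟Γ t = map′ agree-everywhere (λ s≈t i → s≈t (basis i))
                (Finₚ.all? (λ i → ⟦ s ⟧ (basis i) ≟ ⟦ t ⟧ (basis i)))
    where
    agree-everywhere : (∀ i → ⟦ s ⟧ (basis i) ≈ ⟦ t ⟧ (basis i)) → s ≈Γ t
    agree-everywhere on-basis x = trans (basis-expansion s x)
      (trans (sumL-cong degree (λ i → *-congˡ (on-basis i))) (sym (basis-expansion t x)))

  module _ {p} {P : Γ → Set p} (P-resp : ∀ {s t} → s ≈Γ t → P s → P t)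
           (P? : ∀ t → Dec (P t)) where
    all?Γ : Dec (∀ t → P t)
    all?Γ = map′ (λ all-enum t → P-resp (proj₂ (enum-surj t)) (all-enum (proj₁ (enum-surj t))))
                 (λ all-t i → all-t (enum i))
                 (Finₚ.all? (λ i → P? (enum i)))

    any?Γ : Dec (∃ P)
    any?Γ = map′ (λ (i , p) → enum i , p)
                 (λ (t , p) → proj₁ (enum-surj t) , P-resp (λ x → sym (proj₂ (enum-surj t) x)) p)
                 (Finₚ.any? (λ i → P? (enum i)))

  conj? : ∀ τ ρ σ → Dec (Conj τ ρ σ)
  conj? τ ρ σ = σ ≟Γ (τ ∘Γ ρ ∘Γ τ ⁻¹Γ)

  centralises? : ∀ s t → Dec (InCentraliser L s t)
  centralises? s t = (t ∘Γ s) ≟Γ (s ∘Γ t)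

  centFixes? : ∀ ρ a → Dec (CentFixes ρ a)
  centFixes? ρ a = all?Γ {P = λ t → InCentraliser L ρ t → ⟦ t ⟧ a ≈ a}
                         (λ {s} {t} → fixes-resp {s} {t})
                         (λ t → centralises? ρ t →-dec (⟦ t ⟧ a ≟ a))
    where
    fixes-resp : ∀ {s t} → s ≈Γ t → (InCentraliser L ρ s → ⟦ s ⟧ a ≈ a) →
                 InCentraliser L ρ t → ⟦ t ⟧ a ≈ a
    fixes-resp {s} {t} s≈t fixes t∈C =
      trans (sym (s≈t a)) (fixes (centralises-resp {ρ} {t} {s} (λ x → sym (s≈t x)) t∈C))

-- It depends only on the extension of the predicate, which is
-- what makes the choice of one representative per conjugacy class canonical.
module LeastWitness where
  private
    drop-zero : ∀ {m p} {P : Fin (suc m) → Set p} → ¬ P zero → ∃ P → ∃ (λ i → P (suc i))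
    drop-zero ¬p₀ (zero  , p₀) = ⊥-elim (¬p₀ p₀)
    drop-zero ¬p₀ (suc i , pᵢ) = i , pᵢ

  least : ∀ {m p} {P : Fin m → Set p} → (∀ i → Dec (P i)) → ∃ P → ∃ P
  least {zero}  P? (() , _)
  least {suc m} P? w with P? zero
  ... | yes p₀  = zero , p₀
  ... | no  ¬p₀ = let i , pᵢ = least (λ i → P? (suc i)) (drop-zero ¬p₀ w) in suc i , pᵢ

  least-cong : ∀ {m p q} {P : Fin m → Set p} {Q : Fin m → Set q}
               (P? : ∀ i → Dec (P i)) (Q? : ∀ i → Dec (Q i)) →
               (∀ i → P i → Q i) → (∀ i → Q i → P i) →
               (v : ∃ P) (w : ∃ Q) → proj₁ (least P? v) ≡ proj₁ (least Q? w)
  least-cong {zero}  P? Q? P⇒Q Q⇒P (() , _) w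
  least-cong {suc m} P? Q? P⇒Q Q⇒P v w with P? zero | Q? zero
  ... | yes _  | yes _  = ≡.refl
  ... | yes p₀ | no ¬q₀ = ⊥-elim (¬q₀ (P⇒Q zero p₀))
  ... | no ¬p₀ | yes q₀ = ⊥-elim (¬p₀ (Q⇒P zero q₀))
  ... | no ¬p₀ | no ¬q₀ = ≡.cong suc (least-cong (λ i → P? (suc i)) (λ i → Q? (suc i))
                            (λ i → P⇒Q (suc i)) (λ i → Q⇒P (suc i))
                            (drop-zero ¬p₀ v) (drop-zero ¬q₀ w))

module Lemma3p2 {c ℓ : Level} (L : ExtOfℚ c ℓ) (G : IsFiniteGalois L)
                (f : Polyℚ L) (n : ℕ) (α : Fin n → ExtOfℚ.Carrier L)
                (splits : SplitsAs L f n α) where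
  open ExtOfℚ L hiding (zero)
  open IsFiniteGalois G
  open Automorphisms L
  open FiniteGalois L G
  open SplitPolynomials L
  open LeastWitness
  open SetoidReasoning setoid

  roots-lie-in-S₂ : (g : Γ → Carrier) → InA L g → ∀ s → IsRootOf L f (g s) → InS₂ L n α s
  roots-lie-in-S₂ g (_ , equivariant) s root =
    let i , gs≈αᵢ = root-is-some-α splits _≟_ root
    in i , λ t t∈C → Equivalence.from (galOver⇔fixes t) (begin
      ⟦ t ⟧ (α i)  ≈⟨ Homo.⟦⟧-cong t gs≈αᵢ ⟨
      ⟦ t ⟧ (g s)  ≈⟨ equivariant t s s (centraliser-conj-self {s} {t} t∈C) ⟨
      g s          ≈⟨ gs≈αᵢ ⟩
      α i          ∎)

  -- S₂ is closed under conjugation: if τ ρ τ⁻¹ ∈ S₂ then C(ρ) fixes some αᵢ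
  -- (namely the root τ⁻¹ αⱼ).
  S₂-conj : ∀ {τ ρ σ} → Conj τ ρ σ → InS₂ L n α σ → ∃ λ i → CentFixes ρ (α i)
  S₂-conj {τ} {ρ} {σ} σ=τρτ⁻¹ (j , C⊆Galⱼ) =
    let i , τ⁻¹αⱼ≈αᵢ = root-is-some-α splits _≟_ (root-preserved (τ ⁻¹Γ) f (α-is-root splits j))
    in i , centFixes-resp {ρ} τ⁻¹αⱼ≈αᵢ (centFixes-conj {τ} {ρ} {σ} σ=τρτ⁻¹
             (λ t t∈C → Equivalence.to (galOver⇔fixes t) (C⊆Galⱼ t t∈C)))

  IsConjugate : Γ → Γ → Set (c ⊔ ℓ)
  IsConjugate ρ σ = ∃ λ τ → Conj τ ρ σ

  classRep : (σ : Γ) → ∃ λ k → IsConjugate (enum k) σ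
  classRep σ = least (λ k → any?Γ (λ {τ} {τ′} → conj-resp {τ} {τ′} {enum k} {σ})
                                 (λ τ → conj? τ (enum k) σ))
                     (self , idΓ , λ x → sym (self≈σ x))
    where
    self = proj₁ (enum-surj σ)
    self≈σ = proj₂ (enum-surj σ)

  repIndex : Γ → Fin degree
  repIndex σ = proj₁ (classRep σ)

  conjugator : Γ → Γ
  conjugator σ = proj₁ (proj₂ (classRep σ))

  conjugator-conj : ∀ σ → Conj (conjugator σ) (enum (repIndex σ)) σ
  conjugator-conj σ = proj₂ (proj₂ (classRep σ))

  repIndex-conj : ∀ {s t r} → Conj s t r → repIndex t ≡ repIndex r
  repIndex-conj {s} {t} {r} r=sts⁻¹ = least-cong _ _
    (λ k (τ , t=τρτ⁻¹) → s ∘Γ τ , conj-compose {τ} {enum k} {s} {t} {r} t=τρτ⁻¹ r=sts⁻¹)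
    (λ k (τ , r=τρτ⁻¹) → s ⁻¹Γ ∘Γ τ , conj-compose {τ} {enum k} {s ⁻¹Γ} {r} {t} r=τρτ⁻¹
                                         (conj-inverse {s} {t} {r} r=sts⁻¹))
    _ _

  centFixesRoot? : ∀ ρ → Dec (∃ λ i → CentFixes ρ (α i))
  centFixesRoot? ρ = Finₚ.any? (λ i → centFixes? ρ (α i))

  valueAt : Fin degree → Γ → Carrier
  valueAt k τ with centFixesRoot? (enum k)
  ... | yes (i , _) = ⟦ τ ⟧ (α i)
  ... | no _        = 0#

  -- If t = τ ρₖ τ⁻¹, r = τ′ ρₖ τ′⁻¹ and r = s t s⁻¹, then valueAt k τ′ = s (valueAt k τ):
  -- τ′ and s τ both conjugate ρₖ to r, so they agree on roots fixed by C(ρₖ).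
  valueAt-equivariant : ∀ {k k′ τ τ′ s t r} → k ≡ k′ →
    Conj τ (enum k) t → Conj τ′ (enum k′) r → Conj s t r → valueAt k′ τ′ ≈ ⟦ s ⟧ (valueAt k τ)
  valueAt-equivariant {k} {τ = τ} {τ′} {s} {t} {r} ≡.refl t=τρτ⁻¹ r=τ′ρτ′⁻¹ r=sts⁻¹
    with centFixesRoot? (enum k)
  ... | yes (i , fixes) = conjugators-agree {enum k} {r} {τ′} {s ∘Γ τ} fixes r=τ′ρτ′⁻¹
                            (conj-compose {τ} {enum k} {s} {t} {r} t=τρτ⁻¹ r=sts⁻¹)
  ... | no _            = sym (Homo.0#-homo s)

  valueAt-root : ∀ k τ → ∃ (λ i → CentFixes (enum k) (α i)) → IsRootOf L f (valueAt k τ)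
  valueAt-root k τ fixed with centFixesRoot? (enum k)
  ... | yes (i , _) = root-preserved τ f (α-is-root splits i)
  ... | no none     = ⊥-elim (none fixed)

  g : Γ → Carrier
  g σ = valueAt (repIndex σ) (conjugator σ)

  g-equivariant : ∀ s t r → Conj s t r → g r ≈ ⟦ s ⟧ (g t)
  g-equivariant s t r r=sts⁻¹ =
    valueAt-equivariant {repIndex t} {repIndex r} {conjugator t} {conjugator r} {s} {t} {r}
      (repIndex-conj {s} {t} {r} r=sts⁻¹) (conjugator-conj t) (conjugator-conj r) r=sts⁻¹

  -- Well-definedness is equivariance under the identity.
  g∈A : InA L g
  g∈A = (λ s t s≈t → g-equivariant idΓ t s s≈t) , g-equivariant

  -- Since S₂ is closed under conjugation, g takes root values on all of S₂.
  S₂-roots : ∀ s → InS₂ L n α s → IsRootOf L f (g s)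
  S₂-roots s s∈S₂ = valueAt-root (repIndex s) (conjugator s)
    (S₂-conj {conjugator s} {enum (repIndex s)} {s} (conjugator-conj s) s∈S₂)

lemma3p2 : {c ℓ : Level} (L : ExtOfℚ c ℓ) → IsFiniteGalois L →
    (f : Polyℚ L) → Monic L f →
    (n : ℕ) (α : Fin n → ExtOfℚ.Carrier L) → SplitsAs L f n α →
    ((g : Aut L → ExtOfℚ.Carrier L) → InA L g →
       ∀ s → IsRootOf L f (g s) → InS₂ L n α s)
    × (Σ[ g ∈ (Aut L → ExtOfℚ.Carrier L) ] (InA L g ×
       (∀ s → IsRootOf L f (g s) ⇔ InS₂ L n α s)))
lemma3p2 L G f _ n α splits =
  roots-lie-in-S₂ , g , g∈A , λ s → mk⇔ (roots-lie-in-S₂ g g∈A s) (S₂-roots s)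
  where open Lemma3p2 L G f n α splits
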